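{- Let $p$ be a prime, $m\ge1$, and let $h(x)=h_+(x)/h_-(x)\in\mathbb Q(x)$ with $h_+,h_-\in\mathbb Z[x]$ coprime, such that $h(x)\not\equiv0\pmod p$, and let $D\ge1$ be the degree of $h_+(x)$ modulo $p$. Then \[\#\{a \bmod p^m:\ h(a)\equiv0\pmod{p^m},\ h_-(a)\not\equiv0\pmod p\}\le D\,p^{\,m-\lceil m/D\rceil}.\]
   Context: For $a$ with $h_-(a)\not\equiv0\pmod p$, the congruence $h(a)\equiv0\pmod{p^m}$ means $h_+(a)\,\overline{h_-(a)}\equiv 0\pmod{p^m}$, i.e. $h_+(a)\equiv0\pmod{p^m}$. -}

module Defs where

open import Data.Nat as ℕ using (ℕ; zero; suc)
open import Data.Nat.DivMod using (_/_)
open import Data.Integer as ℤ using (ℤ; +_)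
open import Data.Integer.Divisibility using (_∣_)
open import Data.List using (List; []; _∷_; lookup; length)
open import Data.Fin using (Fin; toℕ)
open import Data.Sum using (_⊎_)
open import Data.Product using (∃)
open import Relation.Binary.PropositionalEquality using (_≡_)
open import Relation.Nullary using (¬_)

-- Polynomials in ℤ[x]: coefficient lists, constant term first.
Poly : Set
Poly = List ℤ

eval : Poly → ℤ → ℤ
eval []       x = + 0
eval (c ∷ cs) x = c ℤ.+ x ℤ.* eval cs x

_*ₚ_ : Poly → Poly → Poly
[]       *ₚ g = []
(c ∷ cs) *ₚ g = addP (Data.List.map (c ℤ.*_) g) (+ 0 ∷ (cs *ₚ g))
  where
  addP : Poly → Poly → Poly
  addP []       q        = q
  addP p        []       = p
  addP (a ∷ as) (b ∷ bs) = (a ℤ.+ b) ∷ addP as bs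

-- Equality of polynomials in ℤ[x] (ℤ is infinite, so equality as functions
-- coincides with equality of coefficient sequences up to trailing zeros).
_≈ₚ_ : Poly → Poly → Set
f ≈ₚ g = ∀ x → eval f x ≡ eval g x

CoprimeZX : Poly → Poly → Set
CoprimeZX f g = ∀ d q r → f ≈ₚ (d *ₚ q) → g ≈ₚ (d *ₚ r) →
  (d ≈ₚ (+ 1 ∷ [])) ⊎ (d ≈ₚ (ℤ.- (+ 1) ∷ []))

coeff : Poly → ℕ → ℤ
coeff []       _       = + 0
coeff (c ∷ cs) zero    = c
coeff (c ∷ cs) (suc i) = coeff cs i

DegModP : ℕ → Poly → ℕ → Set
DegModP p f D = ¬ (+ p ∣ coeff f D) × (∀ i → D ℕ.< i → + p ∣ coeff f i)
  where open import Data.Product using (_×_)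

-- ⌈ m / D ⌉ (for D ≥ 1; value at D = 0 irrelevant)
ceilDiv : ℕ → ℕ → ℕ
ceilDiv m zero    = 0
ceilDiv m (suc k) = (m ℕ.+ k) / suc k

-- Count the roots residue class by residue class modulo p. If r is a root of multiplicity e of
-- h₊ modulo p (its Taylor coefficients t j at r satisfy p ∣ t j for j < e and p ∤ t e), then
-- h₊ (r + p y) = p ^ k g (y) with 1 ≤ k ≤ e and g of degree D′ ≤ k modulo p. The roots a ≡ r of h₊
-- modulo p ^ m are sent, at most p ^ (k - 1) to one, to roots of g modulo p ^ (m - k), which
-- induction on m bounds by D′ p ^ ((m - k) - ⌈(m - k) / D′⌉). As ⌈m / D⌉ ≤ 1 + ⌈(m - k) / D′⌉, the
-- class of r contributes at most e p ^ (m - ⌈m / D⌉) roots (when m ≤ k, simply at most p ^ (m - 1)).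
-- Finally the multiplicities add up to at most D, since dividing by x - r lowers the degree by one
-- and keeps the multiplicities at the other residues.

module Submission where

module IntegerPolynomial where

  open import Defs
  open import Data.Nat as ℕ using (ℕ; zero; suc)
  open import Data.Integer using (ℤ; +_; _+_; _*_; _-_; -_; _^_; ∣_∣; 0ℤ; ≢-nonZero)
  import Data.Integer.Properties as ℤ
  open import Data.Integer.Tactic.RingSolver using (solve-∀)
  open import Data.Integer.Divisibility.Signed using (_∣_; divides; ∣⇒∣ᵤ; ∣m∣n⇒∣m+n; ∣n⇒∣m*n; ∣m⇒∣m*n)
  import Data.Nat.Divisibility as ℕ
  import Data.Nat.Properties as ℕ
  open import Data.List using ([]; _∷_; drop; map)
  open import Data.Product using (Σ; _×_; _,_)
  open import Algebra.Properties.AbelianGroup ℤ.+-0-abelianGroup using () renaming (∙-cancelˡ to +-cancelˡ)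
  open import Relation.Nullary using (¬_; contradiction)
  open import Relation.Binary.PropositionalEquality
  open ≡-Reasoning

  divisible-by-all⇒0 : ∀ c → (∀ x → ¬ x ≡ 0ℤ → x ∣ c) → c ≡ 0ℤ
  divisible-by-all⇒0 c all with ∣ c ∣ in ∣c∣≡ | ∣⇒∣ᵤ (all (+ suc ∣ c ∣) λ ())
  ... | zero  | _       = ℤ.∣i∣≡0⇒i≡0 ∣c∣≡
  ... | suc n | 2+n∣1+n = contradiction (ℕ.∣⇒≤ 2+n∣1+n) ℕ.1+n≰n

  head : Poly → ℤ
  head []      = 0ℤ
  head (c ∷ _) = c

  tail : Poly → Poly
  tail []       = []
  tail (_ ∷ cs) = cs

  eval-head-tail : ∀ f x → eval f x ≡ head f + x * eval (tail f) x
  eval-head-tail []      x = sym (trans (ℤ.+-identityˡ _) (ℤ.*-zeroʳ x))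
  eval-head-tail (c ∷ f) x = refl

  coeff-head : ∀ f → coeff f 0 ≡ head f
  coeff-head []      = refl
  coeff-head (c ∷ f) = refl

  coeff-tail : ∀ f j → coeff f (suc j) ≡ coeff (tail f) j
  coeff-tail []      j = refl
  coeff-tail (c ∷ f) j = refl

  module _ {c d : ℤ} {A B : ℤ → ℤ} (agree : ∀ x → ¬ x ≡ 0ℤ → c + x * A x ≡ d + x * B x) where

    constant-unique : c ≡ d
    constant-unique = ℤ.i-j≡0⇒i≡j c d (divisible-by-all⇒0 (c - d) λ x x≢0 →
      divides (B x - A x) (begin
        c - d                         ≡⟨ move c d (x * A x) ⟩
        (c + x * A x) - (d + x * A x) ≡⟨ cong (_- (d + x * A x)) (agree x x≢0) ⟩
        (d + x * B x) - (d + x * A x) ≡⟨ factor d (B x) (A x) x ⟩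
        (B x - A x) * x               ∎))
      where
      move : ∀ c d y → c - d ≡ (c + y) - (d + y)
      move = solve-∀
      factor : ∀ d b a x → (d + x * b) - (d + x * a) ≡ (b - a) * x
      factor = solve-∀

    tail-unique : ∀ x → ¬ x ≡ 0ℤ → A x ≡ B x
    tail-unique x x≢0 = ℤ.*-cancelˡ-≡ x (A x) (B x) {{≢-nonZero x≢0}}
      (+-cancelˡ c _ _ (trans (agree x x≢0) (cong (_+ x * B x) (sym constant-unique))))

  head-tail-agree : ∀ f g → (∀ x → ¬ x ≡ 0ℤ → eval f x ≡ eval g x) →
    ∀ x → ¬ x ≡ 0ℤ → head f + x * eval (tail f) x ≡ head g + x * eval (tail g) x
  head-tail-agree f g f≈g x x≢0 = trans (sym (eval-head-tail f x)) (trans (f≈g x x≢0) (eval-head-tail g x))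

  -- Agreement away from 0 suffices, which is what makes the induction on `j` go through.
  coeff-unique : ∀ f g → (∀ x → ¬ x ≡ 0ℤ → eval f x ≡ eval g x) → ∀ j → coeff f j ≡ coeff g j
  coeff-unique f g f≈g zero = begin
    coeff f 0 ≡⟨ coeff-head f ⟩
    head f    ≡⟨ constant-unique (head-tail-agree f g f≈g) ⟩
    head g    ≡⟨ coeff-head g ⟨
    coeff g 0 ∎
  coeff-unique f g f≈g (suc j) = begin
    coeff f (suc j)  ≡⟨ coeff-tail f j ⟩
    coeff (tail f) j ≡⟨ coeff-unique (tail f) (tail g) tails-agree j ⟩
    coeff (tail g) j ≡⟨ coeff-tail g j ⟨
    coeff g (suc j)  ∎
    where
    tails-agree : ∀ x → ¬ x ≡ 0ℤ → eval (tail f) x ≡ eval (tail g) x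
    tails-agree = tail-unique {head f} {head g} {eval (tail f)} {eval (tail g)} (head-tail-agree f g f≈g)

  eval-0 : ∀ f → eval f 0ℤ ≡ coeff f 0
  eval-0 f = begin
    eval f 0ℤ                         ≡⟨ eval-head-tail f 0ℤ ⟩
    head f + 0ℤ * eval (tail f) 0ℤ    ≡⟨ ℤ.+-identityʳ (head f) ⟩
    head f                            ≡⟨ coeff-head f ⟨
    coeff f 0                         ∎

  head-drop : ∀ f n → head (drop n f) ≡ coeff f n
  head-drop []      zero    = refl
  head-drop []      (suc n) = refl
  head-drop (c ∷ f) zero    = refl
  head-drop (c ∷ f) (suc n) = head-drop f n

  tail-drop : ∀ f n → tail (drop n f) ≡ drop (suc n) f
  tail-drop []      zero    = refl
  tail-drop []      (suc n) = refl
  tail-drop (c ∷ f) zero    = refl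
  tail-drop (c ∷ f) (suc n) = tail-drop f n

  eval-drop : ∀ f n x → eval (drop n f) x ≡ coeff f n + x * eval (drop (suc n) f) x
  eval-drop f n x = begin
    eval (drop n f) x                               ≡⟨ eval-head-tail (drop n f) x ⟩
    head (drop n f) + x * eval (tail (drop n f)) x  ≡⟨ cong₂ (λ c g → c + x * eval g x) (head-drop f n) (tail-drop f n) ⟩
    coeff f n + x * eval (drop (suc n) f) x         ∎

  coeff-drop : ∀ f n i → coeff (drop n f) i ≡ coeff f (n ℕ.+ i)
  coeff-drop []      zero    i = refl
  coeff-drop []      (suc n) i = refl
  coeff-drop (c ∷ f) zero    i = refl
  coeff-drop (c ∷ f) (suc n) i = coeff-drop f n i

  ∣-eval : ∀ {n} f x → (∀ i → n ∣ coeff f i) → n ∣ eval f x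
  ∣-eval []      x n∣f = divides 0ℤ refl
  ∣-eval (c ∷ f) x n∣f = ∣m∣n⇒∣m+n (n∣f 0) (∣n⇒∣m*n x (∣-eval f x (λ i → n∣f (suc i))))

  eval-cong : ∀ {n} f {x y} → n ∣ x - y → n ∣ eval f x - eval f y
  eval-cong []      n∣x-y = divides 0ℤ refl
  eval-cong {n} (c ∷ f) {x} {y} n∣x-y = subst (n ∣_) (expand c x y (eval f x) (eval f y))
    (∣m∣n⇒∣m+n (∣n⇒∣m*n x (eval-cong f n∣x-y)) (∣m⇒∣m*n (eval f y) n∣x-y))
    where
    expand : ∀ c x y a b → x * (a - b) + (x - y) * b ≡ (c + x * a) - (c + y * b)
    expand = solve-∀

  quotient : Poly → ℤ → Poly
  quotient []      s = []
  quotient (c ∷ f) s = eval f s ∷ quotient f s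

  eval-quotient : ∀ f s x → eval f x ≡ (x - s) * eval (quotient f s) x + eval f s
  eval-quotient []      s x = vanish x s
    where
    vanish : ∀ x s → + 0 ≡ (x - s) * + 0 + + 0
    vanish = solve-∀
  eval-quotient (c ∷ f) s x = begin
    c + x * eval f x                                    ≡⟨ cong (λ t → c + x * t) (eval-quotient f s x) ⟩
    c + x * ((x - s) * Q + eval f s)                    ≡⟨ regroup c x s Q (eval f s) ⟩
    (x - s) * (eval f s + x * Q) + (c + s * eval f s)   ∎
    where
    Q = eval (quotient f s) x
    regroup : ∀ c x s q e → c + x * ((x - s) * q + e) ≡ (x - s) * (e + x * q) + (c + s * e)
    regroup = solve-∀

  coeff-quotient : ∀ f s j → coeff (quotient f s) j ≡ eval (drop (suc j) f) s
  coeff-quotient []      s j       = refl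
  coeff-quotient (c ∷ f) s zero    = refl
  coeff-quotient (c ∷ f) s (suc j) = coeff-quotient f s j

  linearMulAdd : ℤ → Poly → ℤ → Poly
  linearMulAdd a []      c = c ∷ []
  linearMulAdd a (d ∷ q) c = (a * d + c) ∷ linearMulAdd a q d

  eval-linearMulAdd : ∀ a q c z → eval (linearMulAdd a q c) z ≡ (a + z) * eval q z + c
  eval-linearMulAdd a []      c z = vanish a c z
    where
    vanish : ∀ a c z → c + z * + 0 ≡ (a + z) * + 0 + c
    vanish = solve-∀
  eval-linearMulAdd a (d ∷ q) c z = begin
    (a * d + c) + z * eval (linearMulAdd a q d) z  ≡⟨ cong (λ t → (a * d + c) + z * t) (eval-linearMulAdd a q d z) ⟩
    (a * d + c) + z * ((a + z) * eval q z + d)     ≡⟨ regroup a d c z (eval q z) ⟩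
    (a + z) * (d + z * eval q z) + c               ∎
    where
    regroup : ∀ a d c z e → (a * d + c) + z * ((a + z) * e + d) ≡ (a + z) * (d + z * e) + c
    regroup = solve-∀

  coeff-linearMulAdd-0 : ∀ a q c → coeff (linearMulAdd a q c) 0 ≡ a * coeff q 0 + c
  coeff-linearMulAdd-0 a []      c = sym (trans (cong (_+ c) (ℤ.*-zeroʳ a)) (ℤ.+-identityˡ c))
  coeff-linearMulAdd-0 a (d ∷ q) c = refl

  coeff-linearMulAdd-suc : ∀ a q c j → coeff (linearMulAdd a q c) (suc j) ≡ a * coeff q (suc j) + coeff q j
  coeff-linearMulAdd-suc a []      c j       = sym (trans (cong (_+ coeff [] j) (ℤ.*-zeroʳ a)) (ℤ.+-identityˡ _))
  coeff-linearMulAdd-suc a (d ∷ q) c zero    = coeff-linearMulAdd-0 a q d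
  coeff-linearMulAdd-suc a (d ∷ q) c (suc j) = coeff-linearMulAdd-suc a q d j

  taylor : Poly → ℤ → Poly
  taylor []      s = []
  taylor (c ∷ f) s = linearMulAdd s (taylor f s) c

  eval-taylor : ∀ f s z → eval (taylor f s) z ≡ eval f (s + z)
  eval-taylor []      s z = refl
  eval-taylor (c ∷ f) s z = begin
    eval (linearMulAdd s (taylor f s) c) z  ≡⟨ eval-linearMulAdd s (taylor f s) c z ⟩
    (s + z) * eval (taylor f s) z + c      ≡⟨ cong (λ t → (s + z) * t + c) (eval-taylor f s z) ⟩
    (s + z) * eval f (s + z) + c          ≡⟨ ℤ.+-comm _ c ⟩
    c + (s + z) * eval f (s + z)          ∎

  taylorCoeff : Poly → ℤ → ℕ → ℤ
  taylorCoeff f s = coeff (taylor f s)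

  taylorCoeff-0 : ∀ f s → taylorCoeff f s 0 ≡ eval f s
  taylorCoeff-0 f s = begin
    coeff (taylor f s) 0  ≡⟨ eval-0 (taylor f s) ⟨
    eval (taylor f s) 0ℤ  ≡⟨ eval-taylor f s 0ℤ ⟩
    eval f (s + 0ℤ)      ≡⟨ cong (eval f) (ℤ.+-identityʳ s) ⟩
    eval f s             ∎

  module _ (f q : Poly) {r c : ℤ} (f≡ : ∀ x → eval f x ≡ (x - r) * eval q x + c) (s : ℤ) where

    private
      L : Poly
      L = linearMulAdd (s - r) (taylor q s) c

      taylor-linear : ∀ z → ¬ z ≡ 0ℤ → eval (taylor f s) z ≡ eval L z
      taylor-linear z _ = begin
        eval (taylor f s) z                        ≡⟨ eval-taylor f s z ⟩
        eval f (s + z)                             ≡⟨ f≡ (s + z) ⟩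
        ((s + z) - r) * eval q (s + z) + c         ≡⟨ cong₂ (λ a t → a * t + c) (regroup s z r) (eval-taylor q s z) ⟨
        ((s - r) + z) * eval (taylor q s) z + c    ≡⟨ eval-linearMulAdd (s - r) (taylor q s) c z ⟨
        eval L z                                   ∎
        where
        regroup : ∀ s z r → (s - r) + z ≡ (s + z) - r
        regroup = solve-∀

    taylorCoeff-linear-0 : taylorCoeff f s 0 ≡ (s - r) * taylorCoeff q s 0 + c
    taylorCoeff-linear-0 =
      trans (coeff-unique (taylor f s) L taylor-linear 0) (coeff-linearMulAdd-0 (s - r) (taylor q s) c)

    taylorCoeff-linear-suc : ∀ j → taylorCoeff f s (suc j) ≡ (s - r) * taylorCoeff q s (suc j) + taylorCoeff q s j
    taylorCoeff-linear-suc j =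
      trans (coeff-unique (taylor f s) L taylor-linear (suc j)) (coeff-linearMulAdd-suc (s - r) (taylor q s) c j)

  taylorCoeff-quotient : ∀ f s j → taylorCoeff f s (suc j) ≡ taylorCoeff (quotient f s) s j
  taylorCoeff-quotient f s j = trans (taylorCoeff-linear-suc f q (eval-quotient f s) s j) (vanish s _ _)
    where
    q = quotient f s
    vanish : ∀ s a b → (s - s) * a + b ≡ b
    vanish = solve-∀

  eval-map-* : ∀ b f y → eval (map (b *_) f) y ≡ b * eval f y
  eval-map-* b []      y = sym (ℤ.*-zeroʳ b)
  eval-map-* b (c ∷ f) y = begin
    b * c + y * eval (map (b *_) f) y  ≡⟨ cong (λ t → b * c + y * t) (eval-map-* b f y) ⟩
    b * c + y * (b * eval f y)         ≡⟨ regroup b c y (eval f y) ⟩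
    b * (c + y * eval f y)             ∎
    where
    regroup : ∀ b c y e → b * c + y * (b * e) ≡ b * (c + y * e)
    regroup = solve-∀

  coeff-map-* : ∀ b f j → coeff (map (b *_) f) j ≡ b * coeff f j
  coeff-map-* b []      j       = sym (ℤ.*-zeroʳ b)
  coeff-map-* b (c ∷ f) zero    = refl
  coeff-map-* b (c ∷ f) (suc j) = coeff-map-* b f j

  scale : ℤ → Poly → Poly
  scale b []      = []
  scale b (c ∷ f) = c ∷ map (b *_) (scale b f)

  eval-scale : ∀ b f y → eval (scale b f) y ≡ eval f (b * y)
  eval-scale b []      y = refl
  eval-scale b (c ∷ f) y = begin
    c + y * eval (map (b *_) (scale b f)) y  ≡⟨ cong (λ t → c + y * t) (eval-map-* b (scale b f) y) ⟩
    c + y * (b * eval (scale b f) y)         ≡⟨ cong (λ t → c + y * (b * t)) (eval-scale b f y) ⟩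
    c + y * (b * eval f (b * y))             ≡⟨ regroup c y b (eval f (b * y)) ⟩
    c + (b * y) * eval f (b * y)             ∎
    where
    regroup : ∀ c y b e → c + y * (b * e) ≡ c + (b * y) * e
    regroup = solve-∀

  coeff-scale : ∀ b f j → coeff (scale b f) j ≡ coeff f j * b ^ j
  coeff-scale b []      j       = sym (ℤ.*-zeroˡ (b ^ j))
  coeff-scale b (c ∷ f) zero    = sym (ℤ.*-identityʳ c)
  coeff-scale b (c ∷ f) (suc j) = begin
    coeff (map (b *_) (scale b f)) j  ≡⟨ coeff-map-* b (scale b f) j ⟩
    b * coeff (scale b f) j           ≡⟨ cong (b *_) (coeff-scale b f j) ⟩
    b * (coeff f j * b ^ j)           ≡⟨ regroup b (coeff f j) (b ^ j) ⟩
    coeff f j * (b * b ^ j)           ∎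
    where
    regroup : ∀ b c q → b * (c * q) ≡ c * (b * q)
    regroup = solve-∀

  divideCoeffs : ∀ {n} f → (∀ j → n ∣ coeff f j) →
    Σ Poly λ g → (∀ j → coeff f j ≡ coeff g j * n) × (∀ y → eval f y ≡ eval g y * n)
  divideCoeffs {n} []  n∣f = [] , (λ _ → sym (ℤ.*-zeroˡ n)) , (λ _ → sym (ℤ.*-zeroˡ n))
  divideCoeffs {n} (c ∷ f) n∣f with n∣f 0 | divideCoeffs f (λ j → n∣f (suc j))
  ... | divides d c≡dn | g , coeffs , evals = d ∷ g , coeffs′ , evals′
    where
    coeffs′ : ∀ j → coeff (c ∷ f) j ≡ coeff (d ∷ g) j * n
    coeffs′ zero    = c≡dn
    coeffs′ (suc j) = coeffs j
    evals′ : ∀ y → eval (c ∷ f) y ≡ eval (d ∷ g) y * n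
    evals′ y = begin
      c + y * eval f y          ≡⟨ cong₂ (λ a b → a + y * b) c≡dn (evals y) ⟩
      d * n + y * (eval g y * n) ≡⟨ regroup d n y (eval g y) ⟩
      (d + y * eval g y) * n    ∎
      where
      regroup : ∀ d n y e → d * n + y * (e * n) ≡ (d + y * e) * n
      regroup = solve-∀

module Multiplicities where

  open import Defs
  open IntegerPolynomial
  open import Data.Nat as ℕ using (ℕ; zero; suc; _<_; _≤_; z≤n; s≤s)
  import Data.Nat.Properties as ℕ
  open import Data.Integer using (ℤ; +_; _*_; _-_; -_; ∣_∣; 0ℤ)
  open import Data.Integer.Tactic.RingSolver using (solve-∀)
  import Data.Integer.Properties as ℤ
  open import Data.Integer.Divisibility.Signed
    using (_∣_; divides; _∣?_; ∣ᵤ⇒∣; ∣⇒∣ᵤ; ∣m+n∣n⇒∣m; ∣m∣n⇒∣m+n; ∣n⇒∣m*n; ∣m⇒∣-m)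
  open import Data.Nat.Primality using (Prime; euclidsLemma)
  open import Data.Nat.Divisibility using () renaming (_∣_ to _ℕ∣_; ∣⇒≤ to ℕ∣⇒≤)
  open import Data.List using ([]; _∷_; drop; map)
  open import Data.Nat.ListAction using (sum)
  open import Data.List.Relation.Unary.All as All using (All; []; _∷_)
  open import Data.List.Relation.Unary.AllPairs using ([]; _∷_)
  open import Data.List.Relation.Unary.Unique.Propositional using (Unique)
  open import Relation.Binary.Definitions using (tri<; tri≈; tri>)
  open import Data.Product using (∃; _×_; _,_)
  open import Data.Sum using (_⊎_; inj₁; inj₂)
  open import Function using (_∘_)
  open import Relation.Nullary using (¬_; yes; no; contradiction)
  open import Relation.Unary using (Decidable)
  open import Relation.Binary.PropositionalEquality

  least-counterexample : ∀ {P : ℕ → Set} → Decidable P → ∀ n → ¬ P n →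
    ∃ λ e → (∀ j → j < e → P j) × ¬ P e
  least-counterexample P? n ¬Pn with P? 0
  ... | no ¬P0 = 0 , (λ _ ()) , ¬P0
  least-counterexample P? zero    ¬P0   | yes P0 = contradiction P0 ¬P0
  least-counterexample {P} P? (suc n) ¬Pn+1 | yes P0
    with e , below , ¬Pe+1 ← least-counterexample {P ∘ suc} (P? ∘ suc) n ¬Pn+1 =
    suc e , below′ , ¬Pe+1
    where
    below′ : ∀ j → j < suc e → P j
    below′ zero    _         = P0
    below′ (suc j) (s≤s j<e) = below j j<e

  last-success : ∀ {P : ℕ → Set} → Decidable P → ∀ n → P 0 → ¬ P n → ∃ λ i → i < n × P i × ¬ P (suc i)
  last-success P? zero    P0 ¬P0 = contradiction P0 ¬P0
  last-success P? (suc n) P0 ¬Pn+1 with P? n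
  ... | yes Pn = n , ℕ.≤-refl , Pn , ¬Pn+1
  ... | no ¬Pn with i , i<n , Pi , ¬Pi+1 ← last-success P? n P0 ¬Pn = i , ℕ.m≤n⇒m≤1+n i<n , Pi , ¬Pi+1

  record HasDegreeMod (π : ℤ) (f : Poly) (D : ℕ) : Set where
    constructor degree
    field
      leading : ¬ π ∣ coeff f D
      beyond  : ∀ i → D < i → π ∣ coeff f i

  module _ {π : ℤ} where

    ∣-eval-drop : ∀ f {D n} x → (∀ i → D < i → π ∣ coeff f i) → D < n → π ∣ eval (drop n f) x
    ∣-eval-drop f {D} {n} x high D<n = ∣-eval (drop n f) x λ i →
      subst (π ∣_) (sym (coeff-drop f n i)) (high (n ℕ.+ i) (ℕ.≤-trans D<n (ℕ.m≤m+n n i)))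

    ¬∣-eval-drop : ∀ {f D} x → HasDegreeMod π f D → ¬ π ∣ eval (drop D f) x
    ¬∣-eval-drop {f} {D} x (degree ¬lead high) π∣ = ¬lead (∣m+n∣n⇒∣m
      (subst (π ∣_) (eval-drop f D x) π∣) (∣n⇒∣m*n x (∣-eval-drop f x high ℕ.≤-refl)))

    degree-quotient : ∀ {f D} s → HasDegreeMod π f (suc D) → HasDegreeMod π (quotient f s) D
    degree-quotient {f} {D} s deg@(degree _ high) = degree
      (λ π∣ → ¬∣-eval-drop s deg (subst (π ∣_) (coeff-quotient f s D) π∣))
      (λ i D<i → subst (π ∣_) (sym (coeff-quotient f s i)) (∣-eval-drop f s high (s≤s D<i)))

    ¬∣-taylorCoeff-degree : ∀ {f} D s → HasDegreeMod π f D → ¬ π ∣ taylorCoeff f s D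
    ¬∣-taylorCoeff-degree {f} zero    s deg π∣ = ¬∣-eval-drop s deg (subst (π ∣_) (taylorCoeff-0 f s) π∣)
    ¬∣-taylorCoeff-degree {f} (suc D) s deg π∣ = ¬∣-taylorCoeff-degree D s (degree-quotient s deg)
      (subst (π ∣_) (taylorCoeff-quotient f s D) π∣)

    degree-or-divisible : ∀ f → (∃ λ D → HasDegreeMod π f D) ⊎ (∀ i → π ∣ coeff f i)
    degree-or-divisible []      = inj₂ λ _ → divides 0ℤ refl
    degree-or-divisible (c ∷ f) with degree-or-divisible f
    ... | inj₁ (D , degree ¬lead high) = inj₁ (suc D , degree ¬lead λ { (suc i) (s≤s D<i) → high i D<i })
    ... | inj₂ all with π ∣? c
    ...   | yes π∣c = inj₂ λ { zero → π∣c ; (suc i) → all i }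
    ...   | no ¬π∣c = inj₁ (0 , degree ¬π∣c λ { (suc i) _ → all i })

  record RootMultiplicity (π : ℤ) (f : Poly) (r : ℤ) (e : ℕ) : Set where
    constructor multiplicity
    field
      below : ∀ j → j < e → π ∣ taylorCoeff f r j
      at    : ¬ π ∣ taylorCoeff f r e

  module _ {π : ℤ} where

    multiplicity-exists : ∀ {f D} r → HasDegreeMod π f D → ∃ λ e → RootMultiplicity π f r e
    multiplicity-exists {f} {D} r deg
      with e , below , at ← least-counterexample (λ j → π ∣? taylorCoeff f r j) D (¬∣-taylorCoeff-degree D r deg) =
      e , multiplicity below at

    multiplicity-≤-degree : ∀ {f D r e} → HasDegreeMod π f D → RootMultiplicity π f r e → e ≤ D
    multiplicity-≤-degree {D = D} {r} {e} deg (multiplicity below _) with e ℕ.≤? D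
    ... | yes e≤D = e≤D
    ... | no  e≰D = contradiction (below D (ℕ.≰⇒> e≰D)) (¬∣-taylorCoeff-degree D r deg)

    multiplicity-quotient : ∀ {f r e} → RootMultiplicity π f r (suc e) → RootMultiplicity π (quotient f r) r e
    multiplicity-quotient {f} {r} {e} (multiplicity below at) = multiplicity
      (λ j j<e → subst (π ∣_) (taylorCoeff-quotient f r j) (below (suc j) (s≤s j<e)))
      (λ π∣ → at (subst (π ∣_) (sym (taylorCoeff-quotient f r e)) π∣))

  module _ {p : ℕ} (prime : Prime p) where

    prime-∣-cancelˡ : ∀ {a b} → ¬ + p ∣ a → + p ∣ a * b → + p ∣ b
    prime-∣-cancelˡ {a} {b} p∤a p∣ab
      with euclidsLemma ∣ a ∣ ∣ b ∣ prime (subst (p ℕ∣_) (ℤ.abs-* a b) (∣⇒∣ᵤ p∣ab))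
    ... | inj₁ p∣a = contradiction (∣ᵤ⇒∣ p∣a) p∤a
    ... | inj₂ p∣b = ∣ᵤ⇒∣ p∣b

    module _ {f : Poly} {r s : ℤ} (p∣f[r] : + p ∣ eval f r) (p∤s-r : ¬ + p ∣ (s - r)) where

      private
        q = quotient f r
        t = taylorCoeff f s
        u = taylorCoeff q s

        u-divisible : ∀ j → (∀ i → i ≤ j → + p ∣ t i) → + p ∣ u j
        u-divisible zero    p∣t = prime-∣-cancelˡ p∤s-r (∣m+n∣n⇒∣m
          (subst (+ p ∣_) (taylorCoeff-linear-0 f q (eval-quotient f r) s) (p∣t 0 z≤n)) p∣f[r])
        u-divisible (suc j) p∣t = prime-∣-cancelˡ p∤s-r (∣m+n∣n⇒∣m
          (subst (+ p ∣_) (taylorCoeff-linear-suc f q (eval-quotient f r) s j) (p∣t (suc j) ℕ.≤-refl))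
          (u-divisible j (λ i i≤j → p∣t i (ℕ.m≤n⇒m≤1+n i≤j))))

        t-divisible : ∀ j → (∀ i → i < j → + p ∣ u i) → + p ∣ u j → + p ∣ t j
        t-divisible zero    _   p∣u = subst (+ p ∣_) (sym (taylorCoeff-linear-0 f q (eval-quotient f r) s))
          (∣m∣n⇒∣m+n (∣n⇒∣m*n (s - r) p∣u) p∣f[r])
        t-divisible (suc j) p∣u p∣uj = subst (+ p ∣_) (sym (taylorCoeff-linear-suc f q (eval-quotient f r) s j))
          (∣m∣n⇒∣m+n (∣n⇒∣m*n (s - r) p∣uj) (p∣u j ℕ.≤-refl))

      multiplicity-quotient-other : ∀ {e} → RootMultiplicity (+ p) f s e → RootMultiplicity (+ p) (quotient f r) s e
      multiplicity-quotient-other {e} (multiplicity below at) = multiplicity below′ λ p∣u → at (t-divisible e below′ p∣u)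
        where
        below′ : ∀ j → j < e → + p ∣ u j
        below′ j j<e = u-divisible j (λ i i≤j → below i (ℕ.≤-<-trans i≤j j<e))

  ∤-gap : ∀ {p r s} → r < s → s < p → ¬ + p ∣ (+ s - + r)
  ∤-gap {p} {r} {s} r<s s<p p∣ = ℕ.<⇒≱ s<p (begin
    p      ≤⟨ ℕ∣⇒≤ (subst (p ℕ∣_) (cong ∣_∣ gap) (∣⇒∣ᵤ p∣)) ⟩
    s ℕ.∸ r ≤⟨ ℕ.m∸n≤m s r ⟩
    s      ∎)
    where
    open ℕ.≤-Reasoning
    instance _ = ℕ.>-nonZero (ℕ.m<n⇒0<n∸m r<s)
    gap : + s - + r ≡ + (s ℕ.∸ r)
    gap = trans (ℤ.m-n≡m⊖n s r) (ℤ.⊖-≥ (ℕ.<⇒≤ r<s))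

  ∤-distinct-residues : ∀ {p r s} → r < p → s < p → ¬ s ≡ r → ¬ + p ∣ (+ s - + r)
  ∤-distinct-residues {p} {r} {s} r<p s<p s≢r p∣ with ℕ.<-cmp r s
  ... | tri< r<s _ _ = ∤-gap r<s s<p p∣
  ... | tri≈ _ r≡s _ = s≢r (sym r≡s)
  ... | tri> _ _ s<r = ∤-gap s<r r<p (subst (+ p ∣_) (negate (+ s) (+ r)) (∣m⇒∣-m p∣))
    where
    negate : ∀ x y → - (x - y) ≡ y - x
    negate = solve-∀

  module _ {p : ℕ} (prime : Prime p) (E : ℕ → ℕ) where

    private
      bound : ∀ {f D} → HasDegreeMod (+ p) f D → ∀ {r e} rs → All (λ s → ¬ r ≡ s) rs → Unique rs →
        All (_< p) (r ∷ rs) → RootMultiplicity (+ p) f (+ r) e →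
        All (λ s → RootMultiplicity (+ p) f (+ s) (E s)) rs → e ℕ.+ sum (map E rs) ≤ D
      bound deg {e = zero} []       _ _ _ _ _ = z≤n
      bound deg {e = zero} (s ∷ rs) _ (s∉rs ∷ u) (_ ∷ s<p ∷ rs<p) _ (ms ∷ mrs) =
        bound deg rs s∉rs u (s<p ∷ rs<p) ms mrs
      bound {D = zero}  deg {e = suc e} _ _ _ _ mr _ = contradiction (multiplicity-≤-degree deg mr) λ ()
      bound {f} {suc D} deg {r} {suc e} rs r∉rs u r<p∷rs<p@(r<p ∷ rs<p) mr mrs =
        s≤s (bound (degree-quotient (+ r) deg) rs r∉rs u r<p∷rs<p (multiplicity-quotient mr)
          (All.zipWith (λ (r≢s , s<p , ms) → multiplicity-quotient-other prime p∣f[r]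
            (∤-distinct-residues r<p s<p (λ s≡r → r≢s (sym s≡r))) ms) (r∉rs , All.zip (rs<p , mrs))))
        where
        p∣f[r] : + p ∣ eval f (+ r)
        p∣f[r] = subst (+ p ∣_) (taylorCoeff-0 f (+ r)) (RootMultiplicity.below mr 0 (s≤s z≤n))

    Σmultiplicity-≤-degree : ∀ {f D} → HasDegreeMod (+ p) f D → ∀ rs → Unique rs → All (_< p) rs →
      All (λ r → RootMultiplicity (+ p) f (+ r) (E r)) rs → sum (map E rs) ≤ D
    Σmultiplicity-≤-degree deg []       _            _     _          = z≤n
    Σmultiplicity-≤-degree deg (r ∷ rs) (r∉rs ∷ u) rs<p (mr ∷ mrs) = bound deg rs r∉rs u rs<p mr mrs

module Counting where

  open import Data.Nat using (ℕ; suc; _+_; _*_; _≤_; _<_; z≤n; s≤s; _≟_; _%_; _/_; NonZero)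
  open import Data.Nat.Properties
  open import Data.Nat.DivMod using (m≡m%n+[m/n]*n; m%n<n; m<n*o⇒m/o<n)
  open import Data.Nat.ListAction using (sum)
  open import Data.List using (List; []; _∷_; length; map; filter; downFrom)
  open import Data.List.Properties using (filter-accept; filter-reject; filter-none; length-map; length-downFrom)
  open import Data.List.Membership.Propositional using (_∈_)
  open import Data.List.Membership.Propositional.Properties using (∈-downFrom⁺)
  open import Data.List.Relation.Unary.Any using (here; there)
  open import Data.List.Relation.Unary.All as All using (All; []; _∷_)
  import Data.List.Relation.Unary.All.Properties as All
  open import Data.List.Relation.Unary.AllPairs using ([]; _∷_)
  open import Data.List.Relation.Unary.Unique.Propositional using (Unique)
  import Data.List.Relation.Unary.Unique.Propositional.Properties as Unique
  open import Data.Product using (_×_; _,_)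
  open import Relation.Nullary using (¬_; yes; no)
  open import Relation.Unary using (Decidable)
  open import Function using (id)
  open import Relation.Binary.PropositionalEquality

  sum-map-mono : ∀ {f g : ℕ → ℕ} → (∀ x → f x ≤ g x) → ∀ xs → sum (map f xs) ≤ sum (map g xs)
  sum-map-mono f≤g []       = z≤n
  sum-map-mono f≤g (x ∷ xs) = +-mono-≤ (f≤g x) (sum-map-mono f≤g xs)

  sum-map-*ʳ : ∀ (f : ℕ → ℕ) c xs → sum (map (λ x → f x * c) xs) ≡ sum (map f xs) * c
  sum-map-*ʳ f c []       = refl
  sum-map-*ʳ f c (x ∷ xs) = trans (cong (f x * c +_) (sum-map-*ʳ f c xs)) (sym (*-distribʳ-+ c (f x) _))

  sum-map-≤-*-length : ∀ {f : ℕ → ℕ} {K} → (∀ x → f x ≤ K) → ∀ xs → sum (map f xs) ≤ length xs * K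
  sum-map-≤-*-length f≤K []       = z≤n
  sum-map-≤-*-length f≤K (x ∷ xs) = +-mono-≤ (f≤K x) (sum-map-≤-*-length f≤K xs)

  sum-map-≤-*-length-filter : ∀ {P : ℕ → Set} (P? : Decidable P) {f : ℕ → ℕ} {K} →
    (∀ x → P x → f x ≤ K) → (∀ x → ¬ P x → f x ≡ 0) → ∀ xs → sum (map f xs) ≤ length (filter P? xs) * K
  sum-map-≤-*-length-filter P? f≤K f≡0 []       = z≤n
  sum-map-≤-*-length-filter P? f≤K f≡0 (x ∷ xs) with P? x
  ... | yes Px = +-mono-≤ (f≤K x Px) (sum-map-≤-*-length-filter P? f≤K f≡0 xs)
  ... | no ¬Px rewrite f≡0 x ¬Px = sum-map-≤-*-length-filter P? f≤K f≡0 xs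

  fibre : (ℕ → ℕ) → ℕ → List ℕ → List ℕ
  fibre φ b = filter (λ x → φ x ≟ b)

  length-filter-∷ : ∀ {P : ℕ → Set} (P? : Decidable P) x xs → length (filter P? xs) ≤ length (filter P? (x ∷ xs))
  length-filter-∷ P? x xs with P? x
  ... | yes _ = n≤1+n _
  ... | no  _ = ≤-refl

  Σ-fibres-∷ : ∀ φ {x} xs bs → φ x ∈ bs →
    suc (sum (map (λ b → length (fibre φ b xs)) bs)) ≤ sum (map (λ b → length (fibre φ b (x ∷ xs))) bs)
  Σ-fibres-∷ φ {x} xs (b ∷ bs) (here φx≡b) = +-mono-≤
    (≤-reflexive (cong length (sym (filter-accept (λ y → φ y ≟ b) φx≡b))))
    (sum-map-mono (λ c → length-filter-∷ (λ y → φ y ≟ c) x xs) bs)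
  Σ-fibres-∷ φ {x} xs (b ∷ bs) (there φx∈bs) = begin
    suc (length (fibre φ b xs) + Σ xs)  ≡⟨ sym (+-suc _ _) ⟩
    length (fibre φ b xs) + suc (Σ xs)  ≤⟨ +-mono-≤ (length-filter-∷ (λ y → φ y ≟ b) x xs)
                                                    (Σ-fibres-∷ φ xs bs φx∈bs) ⟩
    length (fibre φ b (x ∷ xs)) + Σ (x ∷ xs) ∎
    where
    open ≤-Reasoning
    Σ : List ℕ → ℕ
    Σ ys = sum (map (λ c → length (fibre φ c ys)) bs)

  length-≤-Σ-fibres : ∀ φ bs xs → All (λ x → φ x ∈ bs) xs →
    length xs ≤ sum (map (λ b → length (fibre φ b xs)) bs)
  length-≤-Σ-fibres φ bs []       _            = z≤n
  length-≤-Σ-fibres φ bs (x ∷ xs) (φx∈bs ∷ ∈bs) =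
    ≤-trans (s≤s (length-≤-Σ-fibres φ bs xs ∈bs)) (Σ-fibres-∷ φ xs bs φx∈bs)

  length-fibre-unique : ∀ {xs} b → Unique xs → length (fibre id b xs) ≤ 1
  length-fibre-unique {[]}     b _ = z≤n
  length-fibre-unique {x ∷ xs} b (x∉xs ∷ u) with x ≟ b
  ... | yes refl = ≤-reflexive (cong length (trans (filter-accept (λ y → y ≟ b) refl)
    (cong (b ∷_) (filter-none (λ y → y ≟ b) (All.map (λ x≢y y≡x → x≢y (sym y≡x)) x∉xs)))))
  ... | no  x≢b  = subst (_≤ 1) (cong length (sym (filter-reject (λ y → y ≟ b) x≢b))) (length-fibre-unique b u)

  length-unique-< : ∀ {n xs} → Unique xs → All (_< n) xs → length xs ≤ n
  length-unique-< {n} {xs} u xs<n = begin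
    length xs                               ≤⟨ length-≤-Σ-fibres id (downFrom n) xs (All.map ∈-downFrom⁺ xs<n) ⟩
    sum (map (λ b → length (fibre id b xs)) (downFrom n)) ≤⟨ sum-map-≤-*-length (λ b → length-fibre-unique b u) (downFrom n) ⟩
    length (downFrom n) * 1                 ≡⟨ trans (*-identityʳ _) (length-downFrom n) ⟩
    n                                       ∎
    where open ≤-Reasoning

  Unique-map⁺ : ∀ {P : ℕ → Set} (φ : ℕ → ℕ) → (∀ {x y} → P x → P y → φ x ≡ φ y → x ≡ y) →
    ∀ {xs} → All P xs → Unique xs → Unique (map φ xs)
  Unique-map⁺ φ inj []         []         = []
  Unique-map⁺ φ inj (Px ∷ Pxs) (x∉xs ∷ u) =
    All.map⁺ (All.zipWith (λ (x≢y , Py) φx≡φy → x≢y (inj Px Py φx≡φy)) (x∉xs , Pxs)) ∷ Unique-map⁺ φ inj Pxs u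

  %-/-injective : ∀ {x y} n .{{_ : NonZero n}} → x % n ≡ y % n → x / n ≡ y / n → x ≡ y
  %-/-injective {x} {y} n %≡ /≡ = begin
    x                  ≡⟨ m≡m%n+[m/n]*n x n ⟩
    x % n + x / n * n  ≡⟨ cong₂ (λ a b → a + b * n) %≡ /≡ ⟩
    y % n + y / n * n  ≡⟨ m≡m%n+[m/n]*n y n ⟨
    y                  ∎
    where open ≡-Reasoning

  length-≤-periodic : ∀ {P : ℕ → Set} (P? : Decidable P) K M .{{_ : NonZero M}} {ys} → Unique ys →
    All (λ y → y < K * M × P (y % M)) ys → length ys ≤ length (filter P? (downFrom M)) * K
  length-≤-periodic {P} P? K M {ys} u ys-ok = begin
    length ys                                                 ≤⟨ length-≤-Σ-fibres (_% M) (downFrom M) ys residues ⟩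
    sum (map (λ b → length (fibre (_% M) b ys)) (downFrom M)) ≤⟨ sum-map-≤-*-length-filter P? fibre-≤ fibre-empty (downFrom M) ⟩
    length (filter P? (downFrom M)) * K                       ∎
    where
    open ≤-Reasoning
    residues : All (λ y → y % M ∈ downFrom M) ys
    residues = All.tabulate λ {y} _ → ∈-downFrom⁺ (m%n<n y M)
    fibre-≤ : ∀ b → P b → length (fibre (_% M) b ys) ≤ K
    fibre-≤ b _ = begin
      length F              ≡⟨ length-map (_/ M) F ⟨
      length (map (_/ M) F) ≤⟨ length-unique-< unique quotients ⟩
      K                     ∎
      where
      F = fibre (_% M) b ys
      unique : Unique (map (_/ M) F)
      unique = Unique-map⁺ (_/ M) (λ y%M≡b z%M≡b → %-/-injective M (trans y%M≡b (sym z%M≡b)))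
        (All.all-filter _ ys) (Unique.filter⁺ _ u)
      quotients : All (_< K) (map (_/ M) F)
      quotients = All.map⁺ (All.map (λ (y<KM , _) → m<n*o⇒m/o<n y<KM) (All.filter⁺ _ ys-ok))
    fibre-empty : ∀ b → ¬ P b → length (fibre (_% M) b ys) ≡ 0
    fibre-empty b ¬Pb = cong length (filter-none _ (All.map (λ (_ , Py%M) y%M≡b → ¬Pb (subst P y%M≡b Py%M)) ys-ok))

module Exponents where

  open import Defs using (ceilDiv)
  open import Data.Nat using (ℕ; zero; suc; _+_; _*_; _^_; _∸_; _≤_; z≤n; s≤s; _%_; _/_; NonZero; >-nonZero)
  open import Data.Nat.Properties
  open import Data.Nat.DivMod using (m≡m%n+[m/n]*n; m%n<n; m<n*o⇒m/o<n)
  open import Relation.Binary.PropositionalEquality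

  ceilDiv-least : ∀ m {e} x → 1 ≤ e → m ≤ x * e → ceilDiv m e ≤ x
  ceilDiv-least m {suc k} x _ m≤xe = ≤-pred (m<n*o⇒m/o<n (begin-strict
    m + k          <⟨ +-monoʳ-< m (n<1+n k) ⟩
    m + suc k      ≤⟨ +-monoˡ-≤ (suc k) m≤xe ⟩
    x * suc k + suc k ≡⟨ +-comm (x * suc k) (suc k) ⟩
    suc x * suc k  ∎))
    where open ≤-Reasoning

  ≤-ceilDiv-* : ∀ m {e} → 1 ≤ e → m ≤ ceilDiv m e * e
  ≤-ceilDiv-* m {suc k} _ = +-cancelʳ-≤ k m _ (begin
    m + k                                     ≡⟨ m≡m%n+[m/n]*n (m + k) (suc k) ⟩
    (m + k) % suc k + (m + k) / suc k * suc k ≤⟨ +-monoˡ-≤ _ (≤-pred (m%n<n (m + k) (suc k))) ⟩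
    k + (m + k) / suc k * suc k               ≡⟨ +-comm k _ ⟩
    (m + k) / suc k * suc k + k               ∎)
    where open ≤-Reasoning

  ceilDiv-antitone : ∀ m {e D} → 1 ≤ e → e ≤ D → ceilDiv m D ≤ ceilDiv m e
  ceilDiv-antitone m {e} 1≤e e≤D = ceilDiv-least m (ceilDiv m e) (≤-trans 1≤e e≤D)
    (≤-trans (≤-ceilDiv-* m 1≤e) (*-monoʳ-≤ (ceilDiv m e) e≤D))

  ceilDiv-≤ : ∀ m {e} → 1 ≤ e → ceilDiv m e ≤ m
  ceilDiv-≤ m 1≤e = ceilDiv-least m m 1≤e (subst (_≤ m * _) (*-identityʳ m) (*-monoʳ-≤ m 1≤e))

  ceilDiv-≤-1 : ∀ {m e} → 1 ≤ e → m ≤ e → ceilDiv m e ≤ 1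
  ceilDiv-≤-1 {m} 1≤e m≤e = ceilDiv-least m 1 1≤e (subst (m ≤_) (sym (*-identityˡ _)) m≤e)

  ceilDiv-∸ : ∀ m {k e d} → 1 ≤ d → d ≤ k → k ≤ e → k ≤ m → ceilDiv m e ≤ suc (ceilDiv (m ∸ k) d)
  ceilDiv-∸ m {k} {e} {d} 1≤d d≤k k≤e k≤m = ceilDiv-least m (suc c) (≤-trans 1≤d (≤-trans d≤k k≤e)) (begin
    m               ≡⟨ m∸n+n≡m k≤m ⟨
    (m ∸ k) + k     ≤⟨ +-mono-≤ (≤-ceilDiv-* (m ∸ k) 1≤d) k≤e ⟩
    c * d + e       ≤⟨ +-monoˡ-≤ e (*-monoʳ-≤ c (≤-trans d≤k k≤e)) ⟩
    c * e + e       ≡⟨ +-comm (c * e) e ⟩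
    suc c * e       ∎)
    where
    open ≤-Reasoning
    c = ceilDiv (m ∸ k) d

  ∸-+-∸1 : ∀ {a c k} → c ≤ a → 1 ≤ k → (a ∸ c) + (k ∸ 1) ≡ (a + k) ∸ suc c
  ∸-+-∸1 {a} {c} {suc k} c≤a _ = begin
    (a ∸ c) + k        ≡⟨ +-∸-comm k c≤a ⟨
    (a + k) ∸ c        ≡⟨ cong (_∸ suc c) (+-suc a k) ⟨
    (a + suc k) ∸ suc c ∎
    where open ≡-Reasoning

  module _ (b : ℕ) .{{_ : NonZero b}} where

    ^-∸1-split : ∀ {m k} → 1 ≤ k → k ≤ m → b ^ (m ∸ 1) ≡ b ^ (k ∸ 1) * b ^ (m ∸ k)
    ^-∸1-split {m} {k} 1≤k k≤m = begin
      b ^ (m ∸ 1)                ≡⟨ cong (λ x → b ^ (x ∸ 1)) (m∸n+n≡m k≤m) ⟨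
      b ^ (((m ∸ k) + k) ∸ 1)    ≡⟨ cong (b ^_) (∸-+-∸1 {m ∸ k} z≤n 1≤k) ⟨
      b ^ ((m ∸ k) + (k ∸ 1))    ≡⟨ cong (b ^_) (+-comm (m ∸ k) (k ∸ 1)) ⟩
      b ^ ((k ∸ 1) + (m ∸ k))    ≡⟨ ^-distribˡ-+-* b (k ∸ 1) (m ∸ k) ⟩
      b ^ (k ∸ 1) * b ^ (m ∸ k)  ∎
      where open ≡-Reasoning

    ^-bound-m≤e : ∀ {m e D} → 1 ≤ e → m ≤ e → e ≤ D → b ^ (m ∸ 1) ≤ e * b ^ (m ∸ ceilDiv m D)
    ^-bound-m≤e {m} {e} {D} 1≤e m≤e e≤D = begin
      b ^ (m ∸ 1)               ≤⟨ ^-monoʳ-≤ b (∸-monoʳ-≤ m ceilDiv≤1) ⟩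
      b ^ (m ∸ ceilDiv m D)     ≤⟨ m≤n*m _ e {{>-nonZero 1≤e}} ⟩
      e * b ^ (m ∸ ceilDiv m D) ∎
      where
      open ≤-Reasoning
      ceilDiv≤1 : ceilDiv m D ≤ 1
      ceilDiv≤1 = ≤-trans (ceilDiv-antitone m 1≤e e≤D) (ceilDiv-≤-1 1≤e m≤e)

    ^-bound-rescaled : ∀ {m k e D d} → 1 ≤ k → k ≤ m → d ≤ k → k ≤ e → e ≤ D →
      d * b ^ ((m ∸ k) ∸ ceilDiv (m ∸ k) d) * b ^ (k ∸ 1) ≤ e * b ^ (m ∸ ceilDiv m D)
    ^-bound-rescaled {d = zero} _ _ _ _ _ = z≤n
    ^-bound-rescaled {m} {k} {e} {D} {d@(suc _)} 1≤k k≤m d≤k k≤e e≤D = begin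
      d * b ^ ((m ∸ k) ∸ c) * b ^ (k ∸ 1)   ≡⟨ *-assoc d (b ^ ((m ∸ k) ∸ c)) (b ^ (k ∸ 1)) ⟩
      d * (b ^ ((m ∸ k) ∸ c) * b ^ (k ∸ 1)) ≡⟨ cong (d *_) (^-distribˡ-+-* b ((m ∸ k) ∸ c) (k ∸ 1)) ⟨
      d * b ^ (((m ∸ k) ∸ c) + (k ∸ 1))     ≡⟨ cong (λ x → d * b ^ x) (∸-+-∸1 (ceilDiv-≤ (m ∸ k) (s≤s z≤n)) 1≤k) ⟩
      d * b ^ (((m ∸ k) + k) ∸ suc c)       ≡⟨ cong (λ x → d * b ^ (x ∸ suc c)) (m∸n+n≡m k≤m) ⟩
      d * b ^ (m ∸ suc c)                   ≤⟨ *-mono-≤ (≤-trans d≤k k≤e) (^-monoʳ-≤ b (∸-monoʳ-≤ m ceil-step)) ⟩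
      e * b ^ (m ∸ ceilDiv m D)             ∎
      where
      open ≤-Reasoning
      c = ceilDiv (m ∸ k) d
      ceil-step : ceilDiv m D ≤ suc c
      ceil-step = ≤-trans (ceilDiv-antitone m (≤-trans 1≤k k≤e) e≤D) (ceilDiv-∸ m (s≤s z≤n) d≤k k≤e k≤m)

module RootCount where

  open import Defs
  open IntegerPolynomial
  open Multiplicities
  open Counting
  open Exponents
  open import Data.Nat as ℕ using (ℕ; zero; suc; _≤_; _<_; _^_; _∸_; z≤n; s≤s; _%_; _/_; NonZero)
  import Data.Nat.Properties as ℕ
  open import Data.Nat.DivMod using (m≡m%n+[m/n]*n; m%n<n; m<n*o⇒m/o<n)
  open import Data.Nat.Induction using (<-rec)
  open import Data.Nat.Primality using (Prime; prime⇒nonZero)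
  open import Data.Nat.ListAction using (sum)
  open import Data.Integer using (ℤ; +_; _+_; _*_; _-_)
  import Data.Integer as ℤ
  import Data.Integer.Properties as ℤ
  open import Data.Integer.Tactic.RingSolver using (solve-∀)
  open import Data.Integer.Divisibility.Signed
    using (_∣_; divides; _∣?_; ∣-trans; ∣n⇒∣m*n; ∣m⇒∣m*n; ∣m∣n⇒∣m-n)
  open import Data.List using (List; []; _∷_; length; map; filter; downFrom)
  open import Data.List.Properties using (length-map)
  open import Data.List.Membership.Propositional using (_∈_)
  open import Data.List.Membership.Propositional.Properties using (∈-downFrom⁺)
  open import Data.List.Relation.Unary.All as All using (All; []; _∷_)
  import Data.List.Relation.Unary.All.Properties as All
  open import Data.List.Relation.Unary.Unique.Propositional using (Unique)
  import Data.List.Relation.Unary.Unique.Propositional.Properties as Unique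
  open import Data.Product using (_×_; _,_; proj₁; proj₂)
  open import Data.Sum using (inj₁; inj₂)
  open import Function using (id; _∘_)
  open import Relation.Nullary using (¬_; Dec; yes; no; contradiction)
  open import Relation.Binary.PropositionalEquality

  +-%-/ : ∀ a n .{{_ : NonZero n}} → + a ≡ + (a % n) + + (a / n) * + n
  +-%-/ a n = trans (cong +_ (m≡m%n+[m/n]*n a n))
    (trans (ℤ.pos-+ (a % n) _) (cong (λ x → + (a % n) + x) (ℤ.pos-* (a / n) n)))

  ∣-eval-% : ∀ {n} .{{_ : NonZero n}} f a → + n ∣ eval f (+ a) → + n ∣ eval f (+ (a % n))
  ∣-eval-% {n} f a n∣f[a] = subst (+ n ∣_) (cancel (eval f (+ a)) (eval f (+ (a % n))))
    (∣m∣n⇒∣m-n n∣f[a] (eval-cong f (divides (+ (a / n)) (begin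
      + a - + (a % n)                           ≡⟨ cong (_- + (a % n)) (+-%-/ a n) ⟩
      (+ (a % n) + + (a / n) * + n) - + (a % n) ≡⟨ cancel′ (+ (a % n)) (+ (a / n) * + n) ⟩
      + (a / n) * + n                           ∎))))
    where
    open ≡-Reasoning
    cancel : ∀ x y → x - (x - y) ≡ y
    cancel = solve-∀
    cancel′ : ∀ x y → (x + y) - x ≡ y
    cancel′ = solve-∀

  module _ {p : ℕ} (prime : Prime p) where

    instance
      p≢0 : NonZero p
      p≢0 = prime⇒nonZero prime

    infix 10 +p^_
    +p^_ : ℕ → ℤ
    +p^ n = + (p ^ n)

    +p^1 : +p^ 1 ≡ + p
    +p^1 = cong +_ (ℕ.*-identityʳ p)

    +p^-+ : ∀ a b → +p^ (a ℕ.+ b) ≡ +p^ a * +p^ b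
    +p^-+ a b = trans (cong +_ (ℕ.^-distribˡ-+-* p a b)) (ℤ.pos-* (p ^ a) (p ^ b))

    +p^-pow : ∀ n → (+ p) ℤ.^ n ≡ +p^ n
    +p^-pow zero    = refl
    +p^-pow (suc n) = trans (cong (λ x → + p * x) (+p^-pow n)) (sym (ℤ.pos-* p (p ^ n)))

    +p^-∣ : ∀ {i j} → i ≤ j → +p^ i ∣ +p^ j
    +p^-∣ {i} {j} i≤j = divides (+p^ (j ∸ i)) (trans (cong +p^_ (sym (ℕ.m∸n+n≡m i≤j))) (+p^-+ (j ∸ i) i))

    ∣-*+p^-cancelʳ : ∀ a b {x} → +p^ (a ℕ.+ b) ∣ x * +p^ b → +p^ a ∣ x
    ∣-*+p^-cancelʳ a b {x} (divides q x*p^b≡) = divides q (ℤ.*-cancelʳ-≡ x (q * +p^ a) (+p^ b) {{ℕ.m^n≢0 p b}}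
      (trans x*p^b≡ (trans (cong (q *_) (+p^-+ a b)) (sym (ℤ.*-assoc q (+p^ a) (+p^ b))))))

    ∣-*+p^-monoʳ : ∀ a b {x} → +p^ a ∣ x → +p^ (a ℕ.+ b) ∣ x * +p^ b
    ∣-*+p^-monoʳ a b {x} (divides q x≡) = divides q (trans (cong (_* +p^ b) x≡)
      (trans (ℤ.*-assoc q (+p^ a) (+p^ b)) (cong (q *_) (sym (+p^-+ a b)))))

    record Rescaling (f : Poly) (r e : ℕ) : Set where
      field
        k D′     : ℕ
        g        : Poly
        1≤k      : 1 ≤ k
        k≤e      : k ≤ e
        D′≤k     : D′ ≤ k
        degree-g : HasDegreeMod (+ p) g D′
        eval-f   : ∀ a → a % p ≡ r → eval f (+ a) ≡ eval g (+ (a / p)) * +p^ k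

    module _ {f : Poly} {r e : ℕ} (mult : RootMultiplicity (+ p) f (+ r) e) (1≤e : 1 ≤ e) where

      open RootMultiplicity mult

      private
        t : ℕ → ℤ
        t = taylorCoeff f (+ r)

        C : Poly
        C = scale (+ p) (taylor f (+ r))

        coeff-C : ∀ j → coeff C j ≡ t j * +p^ j
        coeff-C j = trans (coeff-scale (+ p) (taylor f (+ r)) j) (cong (t j *_) (+p^-pow j))

        eval-C : ∀ a → a % p ≡ r → eval C (+ (a / p)) ≡ eval f (+ a)
        eval-C a a%p≡r = begin
          eval C (+ (a / p))                ≡⟨ eval-scale (+ p) (taylor f (+ r)) (+ (a / p)) ⟩
          eval (taylor f (+ r)) (+ p * + (a / p)) ≡⟨ eval-taylor f (+ r) (+ p * + (a / p)) ⟩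
          eval f (+ r + + p * + (a / p))     ≡⟨ cong (eval f) residue ⟨
          eval f (+ a)                       ∎
          where
          open ≡-Reasoning
          residue : + a ≡ + r + + p * + (a / p)
          residue = trans (+-%-/ a p) (cong₂ (λ x y → + x + y) a%p≡r (ℤ.*-comm (+ (a / p)) (+ p)))

        +p^-∣-coeff-C : ∀ {i j} → i ≤ j → +p^ i ∣ coeff C j
        +p^-∣-coeff-C {i} {j} i≤j = subst (+p^ i ∣_) (sym (coeff-C j)) (∣n⇒∣m*n (t j) (+p^-∣ i≤j))

        Divisible : ℕ → Set
        Divisible k = ∀ {j} → j < suc e → +p^ k ∣ coeff C j

        divisible? : ∀ k → Dec (Divisible k)
        divisible? k = ℕ.allUpTo? (λ j → +p^ k ∣? coeff C j) (suc e)

        divisible-1 : Divisible 1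
        divisible-1 {zero}  _ = subst (+p^ 1 ∣_) (sym (coeff-C 0))
          (∣m⇒∣m*n (+p^ 0) (subst (_∣ t 0) (sym +p^1) (below 0 1≤e)))
        divisible-1 {suc j} _ = +p^-∣-coeff-C (s≤s z≤n)

        ¬divisible-e+1 : ¬ Divisible (suc e)
        ¬divisible-e+1 divisible = at (subst (_∣ t e) +p^1
          (∣-*+p^-cancelʳ 1 e (subst (+p^ (suc e) ∣_) (coeff-C e) (divisible ℕ.≤-refl))))

        divisible-all : ∀ {k} → k ≤ e → Divisible k → ∀ j → +p^ k ∣ coeff C j
        divisible-all k≤e divisible j with j ℕ.≤? e
        ... | yes j≤e = divisible (s≤s j≤e)
        ... | no  j≰e = +p^-∣-coeff-C (ℕ.≤-trans k≤e (ℕ.<⇒≤ (ℕ.≰⇒> j≰e)))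

        rescale-by : ∀ k → 1 ≤ k → k ≤ e → Divisible k → ¬ Divisible (suc k) → Rescaling f r e
        rescale-by k 1≤k k≤e divisible ¬divisible
          with g , coeff-g , eval-g ← divideCoeffs C (divisible-all k≤e divisible) | degree-or-divisible {+ p} g
        ... | inj₂ p∣g = contradiction (λ {j} _ → +p^k+1∣C j (p∣g j)) ¬divisible
          where
          +p^k+1∣C : ∀ j → + p ∣ coeff g j → +p^ (suc k) ∣ coeff C j
          +p^k+1∣C j p∣gj = subst (+p^ (suc k) ∣_) (sym (coeff-g j))
            (∣-*+p^-monoʳ 1 k (subst (_∣ coeff g j) (sym +p^1) p∣gj))
        ... | inj₁ (D′ , deg) = record
          { k = k ; D′ = D′ ; g = g ; 1≤k = 1≤k ; k≤e = k≤e ; D′≤k = D′≤k ; degree-g = deg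
          ; eval-f = λ a a%p≡r → trans (sym (eval-C a a%p≡r)) (eval-g (+ (a / p))) }
          where
          D′≤k : D′ ≤ k
          D′≤k with D′ ℕ.≤? k
          ... | yes D′≤k = D′≤k
          ... | no  D′≰k = contradiction (subst (_∣ coeff g D′) +p^1 (∣-*+p^-cancelʳ 1 k
            (subst (+p^ (suc k) ∣_) (coeff-g D′) (+p^-∣-coeff-C (ℕ.≰⇒> D′≰k))))) (HasDegreeMod.leading deg)

      rescale : Rescaling f r e
      rescale with i , i<e , divisible , ¬divisible ← last-success (divisible? ∘ suc) e divisible-1 ¬divisible-e+1 =
        rescale-by (suc i) (s≤s z≤n) i<e divisible ¬divisible

    RootsMod : ℕ → Poly → List ℕ → Set
    RootsMod m f = All (λ a → a < p ^ m × +p^ m ∣ eval f (+ a))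

    RootBound : ℕ → Set
    RootBound m = ∀ {D f S} → HasDegreeMod (+ p) f D → Unique S → RootsMod m f S →
      length S ≤ D ℕ.* p ^ (m ∸ ceilDiv m D)

    BoundBelow : ℕ → Set
    BoundBelow m = ∀ {m′} → m′ < m → 1 ≤ m′ → RootBound m′

    /p-< : ∀ {m a} → 1 ≤ m → a < p ^ m → a / p < p ^ (m ∸ 1)
    /p-< {suc m} {a} _ a<p^m+1 = m<n*o⇒m/o<n (subst (a <_) (ℕ.*-comm p (p ^ m)) a<p^m+1)

    lifted-roots-bound : ∀ {m} → BoundBelow m → ∀ {g D′ k e D} → HasDegreeMod (+ p) g D′ →
      1 ≤ k → k < m → D′ ≤ k → k ≤ e → e ≤ D → ∀ {T} → Unique T →
      All (λ y → y < p ^ (m ∸ 1) × +p^ m ∣ eval g (+ y) * +p^ k) T → length T ≤ e ℕ.* p ^ (m ∸ ceilDiv m D)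
    lifted-roots-bound {m} IH {g} {D′} {k} {e} {D} deg 1≤k k<m D′≤k k≤e e≤D {T} unique-T T-ok = begin
      length T                              ≤⟨ length-≤-periodic P? K M unique-T (All.map periodic T-ok) ⟩
      length L ℕ.* K                        ≤⟨ ℕ.*-monoˡ-≤ K (IH m′<m 1≤m′ deg L-unique L-roots) ⟩
      D′ ℕ.* p ^ (m′ ∸ ceilDiv m′ D′) ℕ.* K ≤⟨ ^-bound-rescaled p 1≤k k≤m D′≤k k≤e e≤D ⟩
      e ℕ.* p ^ (m ∸ ceilDiv m D)           ∎
      where
      open ℕ.≤-Reasoning
      k≤m = ℕ.<⇒≤ k<m
      m′ = m ∸ k
      1≤m′ : 1 ≤ m′
      1≤m′ = ℕ.m<n⇒0<n∸m k<m
      m′<m : m′ < m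
      m′<m = ℕ.∸-monoʳ-< 1≤k k≤m
      M = p ^ m′
      instance
        M≢0 : NonZero M
        M≢0 = ℕ.m^n≢0 p m′
      K = p ^ (k ∸ 1)
      P? = λ b → +p^ m′ ∣? eval g (+ b)
      L = filter P? (downFrom M)
      L-unique : Unique L
      L-unique = Unique.filter⁺ P? (Unique.downFrom⁺ M)
      L-roots : RootsMod m′ g L
      L-roots = All.zip (All.filter⁺ P? (All.applyDownFrom⁺₁ id M id) , All.all-filter P? (downFrom M))
      periodic : ∀ {y} → y < p ^ (m ∸ 1) × +p^ m ∣ eval g (+ y) * +p^ k → y < K ℕ.* M × +p^ m′ ∣ eval g (+ (y % M))
      periodic (y< , p^m∣) = subst (_ <_) (^-∸1-split p 1≤k k≤m) y<
        , ∣-eval-% g _ (∣-*+p^-cancelʳ m′ k (subst (λ x → +p^ x ∣ _) (sym (ℕ.m∸n+n≡m k≤m)) p^m∣))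

    rescaled-bound : ∀ {m} → BoundBelow m → 1 ≤ m → ∀ {D f r e S} → Rescaling f r e → e ≤ D →
      Unique S → RootsMod m f S → All (λ a → a % p ≡ r) S → length S ≤ e ℕ.* p ^ (m ∸ ceilDiv m D)
    rescaled-bound {m} IH 1≤m {D} {f} {r} {e} {S} R e≤D u roots ≡r = begin
      length S                    ≡⟨ length-map (_/ p) S ⟨
      length T                    ≤⟨ bound ⟩
      e ℕ.* p ^ (m ∸ ceilDiv m D) ∎
      where
      open Rescaling R
      open ℕ.≤-Reasoning
      T : List ℕ
      T = map (_/ p) S
      unique-T : Unique T
      unique-T = Unique-map⁺ (_/ p) (λ a≡r b≡r → %-/-injective p (trans a≡r (sym b≡r))) ≡r u
      T-ok : All (λ y → y < p ^ (m ∸ 1) × +p^ m ∣ eval g (+ y) * +p^ k) T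
      T-ok = All.map⁺ (All.zipWith (λ ((a<p^m , p^m∣f[a]) , a≡r) →
        /p-< 1≤m a<p^m , subst (+p^ m ∣_) (eval-f _ a≡r) p^m∣f[a]) (roots , ≡r))
      bound : length T ≤ e ℕ.* p ^ (m ∸ ceilDiv m D)
      bound with m ℕ.≤? k
      ... | yes m≤k = ℕ.≤-trans (length-unique-< unique-T (All.map proj₁ T-ok))
        (^-bound-m≤e p (ℕ.≤-trans 1≤k k≤e) (ℕ.≤-trans m≤k k≤e) e≤D)
      ... | no  m≰k = lifted-roots-bound IH degree-g 1≤k (ℕ.≰⇒> m≰k) D′≤k k≤e e≤D unique-T T-ok

    residue-class-bound : ∀ {m} → BoundBelow m → 1 ≤ m → ∀ {D f r e S} → HasDegreeMod (+ p) f D →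
      RootMultiplicity (+ p) f (+ r) e → Unique S → RootsMod m f S → All (λ a → a % p ≡ r) S →
      length S ≤ e ℕ.* p ^ (m ∸ ceilDiv m D)
    residue-class-bound IH 1≤m {e = zero}  deg mult u []                       _ = z≤n
    residue-class-bound {m} IH 1≤m {f = f} {r} {e = zero} deg mult u ((_ , p^m∣f[a]) ∷ _) (a%p≡r ∷ _) =
      contradiction (subst (+ p ∣_) (sym (taylorCoeff-0 f (+ r))) p∣f[r]) (RootMultiplicity.at mult)
      where
      p∣f[r] : + p ∣ eval f (+ r)
      p∣f[r] = subst (λ x → + p ∣ eval f (+ x)) a%p≡r
        (∣-eval-% f _ (∣-trans (subst (_∣ +p^ m) +p^1 (+p^-∣ 1≤m)) p^m∣f[a]))
    residue-class-bound IH 1≤m {e = suc e} deg mult =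
      rescaled-bound IH 1≤m (rescale mult (s≤s z≤n)) (multiplicity-≤-degree deg mult)

    root-bound : ∀ m → 1 ≤ m → RootBound m
    root-bound = <-rec (λ m → 1 ≤ m → RootBound m) λ m IH 1≤m → bound-at m IH 1≤m
      where
      bound-at : ∀ m → BoundBelow m → 1 ≤ m → RootBound m
      bound-at m IH 1≤m {D} {f} {S} deg u roots = begin
        length S                                                 ≤⟨ length-≤-Σ-fibres (_% p) (downFrom p) S residues ⟩
        sum (map (λ r → length (fibre (_% p) r S)) (downFrom p)) ≤⟨ sum-map-mono residue-bound (downFrom p) ⟩
        sum (map (λ r → E r ℕ.* X) (downFrom p))                 ≡⟨ sum-map-*ʳ E X (downFrom p) ⟩
        sum (map E (downFrom p)) ℕ.* X                           ≤⟨ ℕ.*-monoˡ-≤ X Σmultiplicity ⟩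
        D ℕ.* X                                                  ∎
        where
        open ℕ.≤-Reasoning
        X = p ^ (m ∸ ceilDiv m D)
        E : ℕ → ℕ
        E r = proj₁ (multiplicity-exists (+ r) deg)
        mult : ∀ r → RootMultiplicity (+ p) f (+ r) (E r)
        mult r = proj₂ (multiplicity-exists (+ r) deg)
        residues : All (λ a → a % p ∈ downFrom p) S
        residues = All.tabulate λ {a} _ → ∈-downFrom⁺ (m%n<n a p)
        residue-bound : ∀ r → length (fibre (_% p) r S) ≤ E r ℕ.* X
        residue-bound r = residue-class-bound IH 1≤m deg (mult r)
          (Unique.filter⁺ _ u) (All.filter⁺ _ roots) (All.all-filter _ S)
        Σmultiplicity : sum (map E (downFrom p)) ≤ D
        Σmultiplicity = Σmultiplicity-≤-degree prime E deg (downFrom p)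
          (Unique.downFrom⁺ p) (All.applyDownFrom⁺₁ id p id) (All.tabulate λ {r} _ → mult r)

open import Defs
open import Data.Nat using (ℕ; _≤_; _<_; _^_; _*_; _∸_)
open import Data.Nat.Primality using (Prime)
open import Data.Integer using (+_)
open import Data.Integer.Divisibility using (_∣_)
open import Data.List using (List; length)
open import Data.List.Relation.Unary.All using (All)
open import Data.List.Relation.Unary.Unique.Propositional using (Unique)
open import Data.Product using (_×_)
open import Relation.Nullary using (¬_)

open import Data.Product using (_,_)
open import Data.Integer.Divisibility.Signed using (∣ᵤ⇒∣; ∣⇒∣ᵤ)
import Data.List.Relation.Unary.All as All
open Multiplicities using (degree)
open RootCount using (root-bound)

-- The bound holds for all roots of `h₊` modulo `p ^ m`.
proposition2p1 : (p m D : ℕ) → Prime p → 1 ≤ m → (h₊ h₋ : Poly) →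
    ¬ (h₋ ≈ₚ Data.List.[]) → CoprimeZX h₊ h₋ → 1 ≤ D → DegModP p h₊ D →
    (S : List ℕ) → Unique S →
    All (λ a → a < p ^ m × (+ (p ^ m) ∣ eval h₊ (+ a)) × ¬ (+ p ∣ eval h₋ (+ a))) S →
    length S ≤ D * p ^ (m ∸ ceilDiv m D)
proposition2p1 p m D p-prime 1≤m h₊ h₋ _ _ _ (p∤lead , p∣beyond) S unique roots =
  root-bound p-prime m 1≤m {f = h₊}
    (degree (λ p∣ → p∤lead (∣⇒∣ᵤ p∣)) (λ i D<i → ∣ᵤ⇒∣ (p∣beyond i D<i))) unique
    (All.map (λ (a<p^m , p^m∣h₊[a] , _) → a<p^m , ∣ᵤ⇒∣ p^m∣h₊[a]) roots)
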